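{- Let $G$ be a graph on $n$ vertices. Let $s,k\in\mathbb{N}$ with $s\ge k$, and write $s = qk + r$ with $q, r$ the quotient and remainder of $s$ divided by $k$ ($0\le r<k$). Then $$\mathrm{tr}\left(A^{(s)}\right) \le \sqrt{n}\cdot\left\|A^{(k)}\right\|_2^{q}\cdot\left\|A^{(r)}\right\|_F.$$
   Context: Graphs are finite, simple and undirected. A walk of length $s$ is a sequence of vertices $v_0,v_1,\dots,v_s$ with $v_{j}v_{j+1}$ an edge for each $j$; it is non-backtracking if $v_{j+1}\ne v_{j-1}$ for all $1\le j\le s-1$ (no edge is the reverse of the preceding edge). $A^{(s)}$ is the $n\times n$ matrix whose $(u,v)$ entry is the number of non-backtracking walks of length $s$ from $u$ to $v$; in particular $A^{(0)}=\mathrm{Id}$ and $A^{(1)}$ is the adjacency matrix. $\|\cdot\|_2$ is the spectral norm and $\|\cdot\|_F$ the Frobenius norm. -}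

module Defs where

open import Data.Nat as ℕ using (ℕ; zero; suc)
open import Data.Bool using (Bool; true; false; if_then_else_; _∧_; not)
open import Data.Fin using (Fin)
open import Data.Fin.Properties using (_≟_)
open import Data.Maybe using (Maybe; just; nothing)
open import Data.List using (List; map; foldr; allFin)
open import Data.Nat.ListAction using (sum)
open import Data.Integer using (+_)
open import Data.Rational using (ℚ; _+_; _*_; _/_; _≤_; 0ℚ; 1ℚ)
open import Relation.Nullary.Decidable using (⌊_⌋)
open import Relation.Binary.PropositionalEquality using (_≡_)

record Graph (n : ℕ) : Set where
  field
    adj     : Fin n → Fin n → Bool
    symm    : ∀ u v → adj u v ≡ adj v u
    irrefl  : ∀ u → adj u u ≡ false
open Graph public

Σᵛ : {n : ℕ} → (Fin n → ℕ) → ℕ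
Σᵛ {n} f = sum (map f (allFin n))

Σᵛℚ : {n : ℕ} → (Fin n → ℚ) → ℚ
Σᵛℚ {n} f = foldr _+_ 0ℚ (map f (allFin n))

-- nbw G s p c v = number of non-backtracking walks c = v₀, v₁, …, v_s = v
-- of length s, where (if p = just w) the first step may not go to w
-- (p is the vertex preceding c in an ambient walk).
nbw : {n : ℕ} → Graph n → ℕ → Maybe (Fin n) → Fin n → Fin n → ℕ
nbw G zero    p c v = if ⌊ c ≟ v ⌋ then 1 else 0
nbw G (suc s) p c v = Σᵛ (λ w → if adj G c w ∧ notPrev p w then nbw G s (just c) w v else 0)
  where
  notPrev : Maybe (Fin _) → Fin _ → Bool
  notPrev nothing  w = true
  notPrev (just x) w = not ⌊ x ≟ w ⌋

A⁽_⁾ : {n : ℕ} → ℕ → Graph n → Fin n → Fin n → ℕ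
A⁽ s ⁾ G u v = nbw G s nothing u v

ℕ→ℚ : ℕ → ℚ
ℕ→ℚ m = (+ m) / 1

_^ℚ_ : ℚ → ℕ → ℚ
x ^ℚ zero  = 1ℚ
x ^ℚ suc m = x * (x ^ℚ m)

tr : {n : ℕ} → (Fin n → Fin n → ℕ) → ℕ
tr M = Σᵛ (λ i → M i i)

frob² : {n : ℕ} → (Fin n → Fin n → ℕ) → ℕ
frob² M = Σᵛ (λ i → Σᵛ (λ j → M i j ℕ.* M i j))

‖_‖² : {n : ℕ} → (Fin n → ℚ) → ℚ
‖ x ‖² = Σᵛℚ (λ i → x i * x i)

_·_ : {n : ℕ} → (Fin n → Fin n → ℕ) → (Fin n → ℚ) → (Fin n → ℚ)
(M · x) i = Σᵛℚ (λ j → ℕ→ℚ (M i j) * x j)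

-- "‖M‖₂² ≤ σ²": ‖M x‖² ≤ σ² ‖x‖² for all (rational) vectors x, i.e.
-- σ² is an upper bound for the squared spectral norm sup_{x≠0} ‖Mx‖²/‖x‖².
SpecNorm²≤ : {n : ℕ} → (Fin n → Fin n → ℕ) → ℚ → Set
SpecNorm²≤ M σ² = ∀ x → ‖ M · x ‖² ≤ σ² * ‖ x ‖²

-- Cutting a non-backtracking walk of length a + b after a steps leaves a walk of
-- length b that is non-backtracking except possibly at the cut, so
-- A⁽a+b⁾ ≤ A⁽a⁾ A⁽b⁾ entrywise and A⁽qk+r⁾ ≤ P := (A⁽k⁾)^q A⁽r⁾. Hence
-- tr A⁽s⁾ ≤ tr P, and Cauchy–Schwarz on the diagonal gives
-- (tr P)² ≤ n Σᵢ Pᵢᵢ² ≤ n ‖P‖_F². Applying the spectral bound to every column,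
-- ‖A⁽k⁾ N‖_F² ≤ σ² ‖N‖_F², so ‖P‖_F² ≤ σ^{2q} ‖A⁽r⁾‖_F².
module Submission where

open import Defs
open import Data.Nat using (ℕ; _≤_; _<_)
open import Data.Rational using (ℚ)
open import Relation.Binary.PropositionalEquality using (_≡_)
import Data.Nat as N
import Data.Rational as Q

open import Algebra.Bundles using (Ring)
import Algebra.Properties.Semiring.Sum as SemiringSum
open import Data.Bool using (Bool; true; false; if_then_else_; _∧_; not)
open import Data.Fin using (Fin; zero; suc)
open import Data.Fin.Properties using (_≟_)
open import Data.Integer as ℤ using (ℤ; +_)
import Data.Integer.Properties as ℤP
open import Data.List as List using (allFin)
import Data.List.Properties as ListP
open import Data.Maybe using (nothing; just)
open import Data.Nat using (zero; suc; _+_; _*_; z≤n)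
open import Data.Nat.Coprimality using (1-coprimeTo) renaming (sym to coprime-sym)
open import Data.Nat.GeneralisedArithmetic using (fold)
open import Data.Nat.Properties hiding (_≟_)
open import Data.Nat.Tactic.RingSolver using (solve-∀)
open import Data.Rational using (mkℚ; _/_; 0ℚ; NonNegative; Positive)
import Data.Rational.Properties as ℚP
open import Data.Product using (_,_)
open import Data.Sum using ([_,_]′)
import Data.Vec.Functional as Vector
open import Function using (_∘_; id)
open import Relation.Binary.PropositionalEquality
  using (refl; sym; trans; cong; cong₂; subst; subst₂; module ≡-Reasoning)
open import Relation.Nullary.Decidable using (⌊_⌋; dec-true; isYes≗does)

private
  variable
    n : ℕ

module ℕΣ = SemiringSum +-*-semiring
module ℚΣ = SemiringSum (Ring.semiring ℚP.+-*-ring)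

foldr-map-allFin : ∀ {A B : Set} (_∙_ : A → B → B) (e : B) (f : Fin n → A) →
                   List.foldr _∙_ e (List.map f (allFin n)) ≡ Vector.foldr _∙_ e f
foldr-map-allFin {A = A} _∙_ e f =
  trans (cong (List.foldr _∙_ e) (ListP.map-tabulate id f)) (foldr-tabulate f)
  where
  foldr-tabulate : ∀ {m} (g : Fin m → A) → List.foldr _∙_ e (List.tabulate g) ≡ Vector.foldr _∙_ e g
  foldr-tabulate {zero}  g = refl
  foldr-tabulate {suc m} g = cong (g zero ∙_) (foldr-tabulate (g ∘ suc))

Σᵛ≡sum : (f : Fin n → ℕ) → Σᵛ f ≡ ℕΣ.sum f
Σᵛ≡sum = foldr-map-allFin _+_ 0

Σᵛℚ≡sum : (f : Fin n → ℚ) → Σᵛℚ f ≡ ℚΣ.sum f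
Σᵛℚ≡sum = foldr-map-allFin Q._+_ 0ℚ

Σᵛ-cong : {f g : Fin n → ℕ} → (∀ i → f i ≡ g i) → Σᵛ f ≡ Σᵛ g
Σᵛ-cong {f = f} {g} f≗g = trans (Σᵛ≡sum f) (trans (ℕΣ.sum-cong-≗ f≗g) (sym (Σᵛ≡sum g)))

Σᵛ-mono-≤ : {f g : Fin n → ℕ} → (∀ i → f i ≤ g i) → Σᵛ f ≤ Σᵛ g
Σᵛ-mono-≤ {f = f} {g} f≤g = subst₂ _≤_ (sym (Σᵛ≡sum f)) (sym (Σᵛ≡sum g)) (sum-mono f≤g)
  where
  sum-mono : ∀ {m} {f g : Fin m → ℕ} → (∀ i → f i ≤ g i) → ℕΣ.sum f ≤ ℕΣ.sum g
  sum-mono {zero}  _   = z≤n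
  sum-mono {suc m} f≤g = +-mono-≤ (f≤g zero) (sum-mono (f≤g ∘ suc))

term≤Σᵛ : (f : Fin n → ℕ) (i : Fin n) → f i ≤ Σᵛ f
term≤Σᵛ f i = subst (f i ≤_) (sym (Σᵛ≡sum f)) (term≤sum f i)
  where
  term≤sum : ∀ {m} (f : Fin m → ℕ) i → f i ≤ ℕΣ.sum f
  term≤sum f zero    = m≤m+n _ _
  term≤sum f (suc i) = ≤-trans (term≤sum (f ∘ suc) i) (m≤n+m _ _)

Σᵛ-comm : ∀ {m} (f : Fin m → Fin n → ℕ) →
          Σᵛ (λ i → Σᵛ (f i)) ≡ Σᵛ (λ j → Σᵛ (λ i → f i j))
Σᵛ-comm f = begin
  Σᵛ (λ i → Σᵛ (f i))                  ≡⟨ Σᵛ≡sum (λ i → Σᵛ (f i)) ⟩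
  ℕΣ.sum (λ i → Σᵛ (f i))              ≡⟨ ℕΣ.sum-cong-≗ (Σᵛ≡sum ∘ f) ⟩
  ℕΣ.sum (λ i → ℕΣ.sum (f i))          ≡⟨ ℕΣ.∑-comm f ⟩
  ℕΣ.sum (λ j → ℕΣ.sum (λ i → f i j))  ≡⟨ ℕΣ.sum-cong-≗ (λ j → Σᵛ≡sum (λ i → f i j)) ⟨
  ℕΣ.sum (λ j → Σᵛ (λ i → f i j))      ≡⟨ Σᵛ≡sum (λ j → Σᵛ (λ i → f i j)) ⟨
  Σᵛ (λ j → Σᵛ (λ i → f i j))          ∎
  where open ≡-Reasoning

Σᵛ-*-distribʳ : (f : Fin n → ℕ) (x : ℕ) → Σᵛ f * x ≡ Σᵛ (λ i → f i * x)
Σᵛ-*-distribʳ f x = begin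
  Σᵛ f * x                  ≡⟨ cong (_* x) (Σᵛ≡sum f) ⟩
  ℕΣ.sum f * x              ≡⟨ ℕΣ.*-distribʳ-sum x f ⟩
  ℕΣ.sum (λ i → f i * x)    ≡⟨ Σᵛ≡sum (λ i → f i * x) ⟨
  Σᵛ (λ i → f i * x)        ∎
  where open ≡-Reasoning

Σᵛℚ-cong : {f g : Fin n → ℚ} → (∀ i → f i ≡ g i) → Σᵛℚ f ≡ Σᵛℚ g
Σᵛℚ-cong {f = f} {g} f≗g = trans (Σᵛℚ≡sum f) (trans (ℚΣ.sum-cong-≗ f≗g) (sym (Σᵛℚ≡sum g)))

Σᵛℚ-mono-≤ : {f g : Fin n → ℚ} → (∀ i → f i Q.≤ g i) → Σᵛℚ f Q.≤ Σᵛℚ g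
Σᵛℚ-mono-≤ {f = f} {g} f≤g = subst₂ Q._≤_ (sym (Σᵛℚ≡sum f)) (sym (Σᵛℚ≡sum g)) (sum-mono f≤g)
  where
  sum-mono : ∀ {m} {f g : Fin m → ℚ} → (∀ i → f i Q.≤ g i) → ℚΣ.sum f Q.≤ ℚΣ.sum g
  sum-mono {zero}  _   = ℚP.≤-refl
  sum-mono {suc m} f≤g = ℚP.+-mono-≤ (f≤g zero) (sum-mono (f≤g ∘ suc))

Σᵛℚ-*-distribˡ : (x : ℚ) (f : Fin n → ℚ) → x Q.* Σᵛℚ f ≡ Σᵛℚ (λ i → x Q.* f i)
Σᵛℚ-*-distribˡ x f = begin
  x Q.* Σᵛℚ f                ≡⟨ cong (x Q.*_) (Σᵛℚ≡sum f) ⟩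
  x Q.* ℚΣ.sum f             ≡⟨ ℚΣ.*-distribˡ-sum x f ⟩
  ℚΣ.sum (λ i → x Q.* f i)   ≡⟨ Σᵛℚ≡sum (λ i → x Q.* f i) ⟨
  Σᵛℚ (λ i → x Q.* f i)      ∎
  where open ≡-Reasoning

2[m*n]≤m*m+n*n : ∀ m n → 2 * (m * n) ≤ m * m + n * n
2[m*n]≤m*m+n*n m n = [ ordered , swap-ordered ]′ (≤-total m n)
  where
  ordered : ∀ {m n} → m ≤ n → 2 * (m * n) ≤ m * m + n * n
  ordered {m} m≤n with d , refl ← m≤n⇒∃[o]m+o≡n m≤n = begin
    2 * (m * (m + d))              ≤⟨ m≤m+n _ (d * d) ⟩
    2 * (m * (m + d)) + d * d      ≡⟨ expand m d ⟩
    m * m + (m + d) * (m + d)      ∎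
    where
    open ≤-Reasoning
    expand : ∀ m d → 2 * (m * (m + d)) + d * d ≡ m * m + (m + d) * (m + d)
    expand = solve-∀

  swap-ordered : n ≤ m → 2 * (m * n) ≤ m * m + n * n
  swap-ordered n≤m = subst₂ _≤_ (cong (2 *_) (*-comm n m)) (+-comm (n * n) (m * m)) (ordered n≤m)

-- The inductive step of Cauchy–Schwarz: a sum S of n terms with S² ≤ n T
-- is extended by one term a.
+-square-≤ : ∀ n a S T → S * S ≤ n * T → (a + S) * (a + S) ≤ suc n * (a * a + T)
+-square-≤ zero a zero T _ = begin
  (a + 0) * (a + 0)  ≡⟨ cong (λ x → x * x) (+-identityʳ a) ⟩
  a * a              ≤⟨ m≤m+n (a * a) T ⟩
  a * a + T          ≡⟨ +-identityʳ (a * a + T) ⟨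
  1 * (a * a + T)    ∎
  where open ≤-Reasoning
+-square-≤ zero a (suc S) T ()
+-square-≤ n@(suc _) a S T S²≤nT = begin
  (a + S) * (a + S)                     ≡⟨ expand a S ⟩
  a * a + 2 * (a * S) + S * S           ≤⟨ +-mono-≤ (+-monoʳ-≤ (a * a) cross) S²≤nT ⟩
  a * a + (n * (a * a) + T) + n * T     ≡⟨ collect n a T ⟩
  suc n * (a * a + T)                   ∎
  where
  open ≤-Reasoning
  expand : ∀ a S → (a + S) * (a + S) ≡ a * a + 2 * (a * S) + S * S
  expand = solve-∀
  collect : ∀ n a T → a * a + (n * (a * a) + T) + n * T ≡ suc n * (a * a + T)
  collect = solve-∀
  cross : 2 * (a * S) ≤ n * (a * a) + T
  cross = *-cancelˡ-≤ n (begin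
    n * (2 * (a * S))            ≡⟨ regroup n a S ⟩
    2 * ((n * a) * S)            ≤⟨ 2[m*n]≤m*m+n*n (n * a) S ⟩
    (n * a) * (n * a) + S * S    ≤⟨ +-monoʳ-≤ _ S²≤nT ⟩
    (n * a) * (n * a) + n * T    ≡⟨ factor n a T ⟩
    n * (n * (a * a) + T)        ∎)
    where
    regroup : ∀ n a S → n * (2 * (a * S)) ≡ 2 * ((n * a) * S)
    regroup = solve-∀
    factor : ∀ n a T → (n * a) * (n * a) + n * T ≡ n * (n * (a * a) + T)
    factor = solve-∀

Σᵛ-square-≤ : (y : Fin n → ℕ) → Σᵛ y * Σᵛ y ≤ n * Σᵛ (λ i → y i * y i)
Σᵛ-square-≤ {n} y =
  subst₂ (λ S T → S * S ≤ n * T) (sym (Σᵛ≡sum y)) (sym (Σᵛ≡sum (λ i → y i * y i))) (sum-square-≤ y)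
  where
  sum-square-≤ : ∀ {m} (y : Fin m → ℕ) → ℕΣ.sum y * ℕΣ.sum y ≤ m * ℕΣ.sum (λ i → y i * y i)
  sum-square-≤ {zero}  y = z≤n
  sum-square-≤ {suc m} y = +-square-≤ m (y zero) _ _ (sum-square-≤ (y ∘ suc))

-- In this normal form (denominator 1) the operations of ℚ reduce to integer
-- arithmetic on numerators.
ℕ→ℚ≡mkℚ : ∀ m → ℕ→ℚ m ≡ mkℚ (+ m) 0 (coprime-sym (1-coprimeTo m))
ℕ→ℚ≡mkℚ m = ℚP.normalize-coprime _

ℤ/1-cong : {i j : ℤ} → i ≡ j → i / 1 ≡ j / 1
ℤ/1-cong = cong (_/ 1)

ℕ→ℚ-+ : ∀ a b → ℕ→ℚ (a + b) ≡ ℕ→ℚ a Q.+ ℕ→ℚ b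
ℕ→ℚ-+ a b rewrite ℕ→ℚ≡mkℚ a | ℕ→ℚ≡mkℚ b =
  ℤ/1-cong {j = + a ℤ.* + 1 ℤ.+ + b ℤ.* + 1}
    (sym (cong₂ ℤ._+_ (ℤP.*-identityʳ (+ a)) (ℤP.*-identityʳ (+ b))))

ℕ→ℚ-* : ∀ a b → ℕ→ℚ (a * b) ≡ ℕ→ℚ a Q.* ℕ→ℚ b
ℕ→ℚ-* a b rewrite ℕ→ℚ≡mkℚ a | ℕ→ℚ≡mkℚ b = ℤ/1-cong {j = + a ℤ.* + b} (ℤP.pos-* a b)

ℕ→ℚ-mono-≤ : ∀ {a b} → a ≤ b → ℕ→ℚ a Q.≤ ℕ→ℚ b
ℕ→ℚ-mono-≤ {a} {b} a≤b rewrite ℕ→ℚ≡mkℚ a | ℕ→ℚ≡mkℚ b =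
  Q.*≤* (ℤP.*-monoʳ-≤-nonNeg (+ 1) (ℤ.+≤+ a≤b))

ℕ→ℚ-nonNeg : ∀ m → NonNegative (ℕ→ℚ m)
ℕ→ℚ-nonNeg m = Q.nonNegative (ℕ→ℚ-mono-≤ {0} {m} z≤n)

ℕ→ℚ-pos : ∀ {m} → 0 < m → Positive (ℕ→ℚ m)
ℕ→ℚ-pos {suc m} _ = subst Positive (sym (ℕ→ℚ≡mkℚ (suc m))) _

ℕ→ℚ-Σᵛ : (f : Fin n → ℕ) → ℕ→ℚ (Σᵛ f) ≡ Σᵛℚ (ℕ→ℚ ∘ f)
ℕ→ℚ-Σᵛ f = trans (cong ℕ→ℚ (Σᵛ≡sum f)) (trans (ℕ→ℚ-sum f) (sym (Σᵛℚ≡sum (ℕ→ℚ ∘ f))))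
  where
  ℕ→ℚ-sum : ∀ {m} (f : Fin m → ℕ) → ℕ→ℚ (ℕΣ.sum f) ≡ ℚΣ.sum (ℕ→ℚ ∘ f)
  ℕ→ℚ-sum {zero}  f = refl
  ℕ→ℚ-sum {suc m} f = trans (ℕ→ℚ-+ (f zero) _) (cong (ℕ→ℚ (f zero) Q.+_) (ℕ→ℚ-sum (f ∘ suc)))

Mat : ℕ → Set
Mat n = Fin n → Fin n → ℕ

_⊛_ : Mat n → Mat n → Mat n
(M ⊛ N) u v = Σᵛ (λ w → M u w * N w v)

_*ᵛ_ : Mat n → (Fin n → ℕ) → Fin n → ℕ
(M *ᵛ x) u = Σᵛ (λ w → M u w * x w)

‖_‖²ℕ : (Fin n → ℕ) → ℕ
‖ x ‖²ℕ = Σᵛ (λ i → x i * x i)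

_≤ₘ_ : Mat n → Mat n → Set
M ≤ₘ N = ∀ u v → M u v ≤ N u v

⊛-monoʳ-≤ : (M : Mat n) {N N′ : Mat n} → N ≤ₘ N′ → (M ⊛ N) ≤ₘ (M ⊛ N′)
⊛-monoʳ-≤ M N≤N′ u v = Σᵛ-mono-≤ (λ w → *-monoʳ-≤ (M u w) (N≤N′ w v))

tr-mono-≤ : {M N : Mat n} → M ≤ₘ N → tr M ≤ tr N
tr-mono-≤ M≤N = Σᵛ-mono-≤ (λ i → M≤N i i)

tr*tr≤n*frob² : (M : Mat n) → tr M * tr M ≤ n * frob² M
tr*tr≤n*frob² {n} M = ≤-trans (Σᵛ-square-≤ (λ i → M i i))
  (*-monoʳ-≤ n (Σᵛ-mono-≤ (λ i → term≤Σᵛ (λ j → M i j * M i j) i)))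

frob²-by-columns : (M : Mat n) → frob² M ≡ Σᵛ (λ v → ‖ (λ u → M u v) ‖²ℕ)
frob²-by-columns M = Σᵛ-comm (λ u v → M u v * M u v)

‖‖²-cong : {x y : Fin n → ℚ} → (∀ i → x i ≡ y i) → ‖ x ‖² ≡ ‖ y ‖²
‖‖²-cong x≗y = Σᵛℚ-cong (λ i → cong₂ Q._*_ (x≗y i) (x≗y i))

‖ℕ→ℚ‖² : (x : Fin n → ℕ) → ‖ ℕ→ℚ ∘ x ‖² ≡ ℕ→ℚ ‖ x ‖²ℕ
‖ℕ→ℚ‖² x = trans (Σᵛℚ-cong (λ i → sym (ℕ→ℚ-* (x i) (x i)))) (sym (ℕ→ℚ-Σᵛ (λ i → x i * x i)))

·-ℕ→ℚ : (M : Mat n) (x : Fin n → ℕ) (u : Fin n) → (M · (ℕ→ℚ ∘ x)) u ≡ ℕ→ℚ ((M *ᵛ x) u)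
·-ℕ→ℚ M x u = trans (Σᵛℚ-cong (λ w → sym (ℕ→ℚ-* (M u w) (x w)))) (sym (ℕ→ℚ-Σᵛ (λ w → M u w * x w)))

SpecNorm²≤-ℕ : {M : Mat n} {σ² : ℚ} → SpecNorm²≤ M σ² →
               (x : Fin n → ℕ) → ℕ→ℚ ‖ M *ᵛ x ‖²ℕ Q.≤ σ² Q.* ℕ→ℚ ‖ x ‖²ℕ
SpecNorm²≤-ℕ {M = M} {σ²} bound x = subst₂ Q._≤_
  (trans (‖‖²-cong (·-ℕ→ℚ M x)) (‖ℕ→ℚ‖² (M *ᵛ x)))
  (cong (σ² Q.*_) (‖ℕ→ℚ‖² x))
  (bound (ℕ→ℚ ∘ x))

SpecNorm²≤⇒nonNeg : {M : Mat (suc n)} {σ² : ℚ} → SpecNorm²≤ M σ² → NonNegative σ²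
SpecNorm²≤⇒nonNeg {n} {M = M} {σ²} bound = Q.nonNegative (ℚP.*-cancelʳ-≤-pos {0ℚ} {σ²} ‖𝟙‖² (begin
  0ℚ Q.* ‖𝟙‖²              ≡⟨ ℚP.*-zeroˡ ‖𝟙‖² ⟩
  0ℚ                       ≤⟨ ℚP.nonNegative⁻¹ _ {{ℕ→ℚ-nonNeg ‖ M *ᵛ 𝟙 ‖²ℕ}} ⟩
  ℕ→ℚ ‖ M *ᵛ 𝟙 ‖²ℕ         ≤⟨ SpecNorm²≤-ℕ {M = M} {σ²} bound 𝟙 ⟩
  σ² Q.* ‖𝟙‖²              ∎))
  where
  open ℚP.≤-Reasoning
  𝟙 : Fin (suc n) → ℕ
  𝟙 _ = 1
  ‖𝟙‖² : ℚ
  ‖𝟙‖² = ℕ→ℚ ‖ 𝟙 ‖²ℕ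
  instance
    ‖𝟙‖²-pos : Positive ‖𝟙‖²
    ‖𝟙‖²-pos = ℕ→ℚ-pos (term≤Σᵛ (λ i → 𝟙 i * 𝟙 i) zero)

frob²-⊛-≤ : {M : Mat n} {σ² : ℚ} → SpecNorm²≤ M σ² →
            (N : Mat n) → ℕ→ℚ (frob² (M ⊛ N)) Q.≤ σ² Q.* ℕ→ℚ (frob² N)
frob²-⊛-≤ {n} {M = M} {σ²} bound N = begin
  ℕ→ℚ (frob² (M ⊛ N))                  ≡⟨ cong ℕ→ℚ (frob²-by-columns (M ⊛ N)) ⟩
  ℕ→ℚ (Σᵛ (λ v → ‖ M *ᵛ col v ‖²ℕ))    ≡⟨ ℕ→ℚ-Σᵛ (λ v → ‖ M *ᵛ col v ‖²ℕ) ⟩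
  Σᵛℚ (λ v → ℕ→ℚ ‖ M *ᵛ col v ‖²ℕ)     ≤⟨ Σᵛℚ-mono-≤ (SpecNorm²≤-ℕ {M = M} {σ²} bound ∘ col) ⟩
  Σᵛℚ (λ v → σ² Q.* ℕ→ℚ ‖ col v ‖²ℕ)   ≡⟨ Σᵛℚ-*-distribˡ σ² (λ v → ℕ→ℚ ‖ col v ‖²ℕ) ⟨
  σ² Q.* Σᵛℚ (λ v → ℕ→ℚ ‖ col v ‖²ℕ)   ≡⟨ cong (σ² Q.*_) (ℕ→ℚ-Σᵛ (λ v → ‖ col v ‖²ℕ)) ⟨
  σ² Q.* ℕ→ℚ (Σᵛ (λ v → ‖ col v ‖²ℕ))  ≡⟨ cong (λ F → σ² Q.* ℕ→ℚ F) (frob²-by-columns N) ⟨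
  σ² Q.* ℕ→ℚ (frob² N)                 ∎
  where
  open ℚP.≤-Reasoning
  col : Fin n → Fin n → ℕ
  col v w = N w v

frob²-power-≤ : {M : Mat n} {σ² : ℚ} .{{_ : NonNegative σ²}} → SpecNorm²≤ M σ² →
                (t : ℕ) (N : Mat n) → ℕ→ℚ (frob² (fold N (M ⊛_) t)) Q.≤ (σ² ^ℚ t) Q.* ℕ→ℚ (frob² N)
frob²-power-≤ bound zero    N = ℚP.≤-reflexive (sym (ℚP.*-identityˡ _))
frob²-power-≤ {n} {M = M} {σ²} bound (suc t) N = begin
  ℕ→ℚ (frob² (M ⊛ Mᵗ N))                     ≤⟨ frob²-⊛-≤ {M = M} {σ²} bound (Mᵗ N) ⟩
  σ² Q.* ℕ→ℚ (frob² (Mᵗ N))                  ≤⟨ ℚP.*-monoˡ-≤-nonNeg σ² (frob²-power-≤ {M = M} bound t N) ⟩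
  σ² Q.* ((σ² ^ℚ t) Q.* ℕ→ℚ (frob² N))       ≡⟨ ℚP.*-assoc σ² (σ² ^ℚ t) _ ⟨
  (σ² ^ℚ suc t) Q.* ℕ→ℚ (frob² N)            ∎
  where
  open ℚP.≤-Reasoning
  Mᵗ : Mat n → Mat n
  Mᵗ N = fold N (M ⊛_) t

if-∧-≤ : ∀ b c (x : ℕ) → (if b ∧ c then x else 0) ≤ (if b ∧ true then x else 0)
if-∧-≤ false c    x = z≤n
if-∧-≤ true  false x = z≤n
if-∧-≤ true  true  x = ≤-refl

Σᵛ-comm-*ʳ : ∀ {m} (F : Fin m → Fin n → ℕ) (R : Fin n → ℕ) →
             Σᵛ (λ x → Σᵛ (λ w → F x w * R w)) ≡ Σᵛ (λ w → Σᵛ (λ x → F x w) * R w)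
Σᵛ-comm-*ʳ F R = trans (Σᵛ-comm (λ x w → F x w * R w))
                       (Σᵛ-cong (λ w → sym (Σᵛ-*-distribʳ (λ x → F x w) (R w))))

Σᵛ-guard-≤ : ∀ (e : Fin n → Bool) {X : Fin n → ℕ} {F : Fin n → Fin n → ℕ} {R : Fin n → ℕ} →
             (∀ x → X x ≤ Σᵛ (λ w → F x w * R w)) →
             Σᵛ (λ x → if e x then X x else 0) ≤ Σᵛ (λ w → Σᵛ (λ x → if e x then F x w else 0) * R w)
Σᵛ-guard-≤ e {X} {F} {R} X≤ =
  ≤-trans (Σᵛ-mono-≤ guarded) (≤-reflexive (Σᵛ-comm-*ʳ (λ x w → if e x then F x w else 0) R))
  where
  guarded : ∀ x → (if e x then X x else 0) ≤ Σᵛ (λ w → (if e x then F x w else 0) * R w)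
  guarded x with e x
  ... | true  = X≤ x
  ... | false = z≤n

module _ (G : Graph n) where

  nbw-≤-A⁽⁾ : ∀ s p c v → nbw G s p c v ≤ A⁽ s ⁾ G c v
  nbw-≤-A⁽⁾ zero    p c v = ≤-refl
  nbw-≤-A⁽⁾ (suc s) p c v = Σᵛ-mono-≤ (λ w → if-∧-≤ (adj G c w) _ _)

  nbw-+-≤ : ∀ a b p c v → nbw G (a + b) p c v ≤ Σᵛ (λ w → nbw G a p c w * A⁽ b ⁾ G w v)
  nbw-+-≤ zero b p c v = begin
    nbw G b p c v                  ≤⟨ nbw-≤-A⁽⁾ b p c v ⟩
    A⁽ b ⁾ G c v                   ≡⟨ +-identityʳ _ ⟨
    1 * A⁽ b ⁾ G c v               ≡⟨ cong (λ δ → (if δ then 1 else 0) * A⁽ b ⁾ G c v) c≟c ⟨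
    nbw G 0 p c c * A⁽ b ⁾ G c v   ≤⟨ term≤Σᵛ (λ w → nbw G 0 p c w * A⁽ b ⁾ G w v) c ⟩
    Σᵛ (λ w → nbw G 0 p c w * A⁽ b ⁾ G w v) ∎
    where
    open ≤-Reasoning
    c≟c : ⌊ c ≟ c ⌋ ≡ true
    c≟c = trans (isYes≗does (c ≟ c)) (dec-true (c ≟ c) refl)
  nbw-+-≤ (suc a) b nothing  c v =
    Σᵛ-guard-≤ (λ x → adj G c x ∧ true) (λ x → nbw-+-≤ a b (just c) x v)
  nbw-+-≤ (suc a) b (just y) c v =
    Σᵛ-guard-≤ (λ x → adj G c x ∧ not ⌊ y ≟ x ⌋) (λ x → nbw-+-≤ a b (just c) x v)

  A⁽q*k+r⁾≤ : ∀ k r q → A⁽ q * k + r ⁾ G ≤ₘ fold (A⁽ r ⁾ G) (A⁽ k ⁾ G ⊛_) q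
  A⁽q*k+r⁾≤ k r zero    u v = ≤-refl
  A⁽q*k+r⁾≤ k r (suc q) u v rewrite +-assoc k (q * k) r =
    ≤-trans (nbw-+-≤ k (q * k + r) nothing u v) (⊛-monoʳ-≤ (A⁽ k ⁾ G) (A⁽q*k+r⁾≤ k r q) u v)

lemmaA4 : (n : ℕ) (G : Graph n) (s k q r : ℕ) → k ≤ s → r < k → s ≡ q N.* k N.+ r →
          (σ² : ℚ) → SpecNorm²≤ (A⁽ k ⁾ G) σ² →
          ℕ→ℚ (tr (A⁽ s ⁾ G) N.* tr (A⁽ s ⁾ G))
            Q.≤ ℕ→ℚ n Q.* (σ² ^ℚ q) Q.* ℕ→ℚ (frob² (A⁽ r ⁾ G))
-- The bound holds for every decomposition s = q k + r. For n = 0 both sides vanish, while σ² need not be nonnegative.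
lemmaA4 zero G s k q r _ _ _ σ² _ =
  ℚP.≤-reflexive (sym (trans (cong (Q._* F) (ℚP.*-zeroˡ (σ² ^ℚ q))) (ℚP.*-zeroˡ F)))
  where
  F : ℚ
  F = ℕ→ℚ (frob² (A⁽ r ⁾ G))
lemmaA4 n@(suc _) G _ k q r _ _ refl σ² bound = begin
  ℕ→ℚ (tr (A⁽ s ⁾ G) * tr (A⁽ s ⁾ G))         ≤⟨ ℕ→ℚ-mono-≤ (*-mono-≤ tr≤ tr≤) ⟩
  ℕ→ℚ (tr P * tr P)                          ≤⟨ ℕ→ℚ-mono-≤ (tr*tr≤n*frob² P) ⟩
  ℕ→ℚ (n * frob² P)                          ≡⟨ ℕ→ℚ-* n (frob² P) ⟩
  ℕ→ℚ n Q.* ℕ→ℚ (frob² P)                    ≤⟨ ℚP.*-monoˡ-≤-nonNeg (ℕ→ℚ n) {{ℕ→ℚ-nonNeg n}} frob²P≤ ⟩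
  ℕ→ℚ n Q.* ((σ² ^ℚ q) Q.* ℕ→ℚ (frob² C))     ≡⟨ ℚP.*-assoc (ℕ→ℚ n) (σ² ^ℚ q) _ ⟨
  ℕ→ℚ n Q.* (σ² ^ℚ q) Q.* ℕ→ℚ (frob² C)       ∎
  where
  open ℚP.≤-Reasoning
  s : ℕ
  s = q * k + r
  C P : Mat n
  C = A⁽ r ⁾ G
  P = fold C (A⁽ k ⁾ G ⊛_) q
  tr≤ : tr (A⁽ s ⁾ G) ≤ tr P
  tr≤ = tr-mono-≤ (A⁽q*k+r⁾≤ G k r q)
  instance
    σ²-nonNeg : NonNegative σ²
    σ²-nonNeg = SpecNorm²≤⇒nonNeg {M = A⁽ k ⁾ G} {σ²} bound
  frob²P≤ : ℕ→ℚ (frob² P) Q.≤ (σ² ^ℚ q) Q.* ℕ→ℚ (frob² C)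
  frob²P≤ = frob²-power-≤ {M = A⁽ k ⁾ G} {σ²} bound q C
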